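{- Let $\Gamma=K_{n,n}$ with $n\geqslant 2$ and suppose $\mathrm{Alt}(n)\times\mathrm{Alt}(n)\leqslant G\leqslant\mathrm{Sym}(n)\wr\mathrm{Sym}(2)=\mathrm{Aut}(\Gamma)$ with $G$ transitive on $V\Gamma$. Then $D(G)=n-1$ if $G^+=\mathrm{Alt}(n)\times\mathrm{Alt}(n)$; $D(G)=n$ if $G^+=\langle\mathrm{Alt}(n)\times\mathrm{Alt}(n),((1,2),(1,2))\rangle$; and $D(G)=n+1$ if $G^+=\mathrm{Sym}(n)\times\mathrm{Sym}(n)$.
   Context: $D(G)$ is the smallest $k$ such that there is a partition of the vertex set into $k$ parts whose setwise stabilisers in $G$ intersect trivially. The parts of $\Gamma$ are $\Delta=\{v_1,\dots,v_n\}$, $\Delta'=\{u_1,\dots,u_n\}$, and $(g,g')\in\mathrm{Sym}(n)\times\mathrm{Sym}(n)$ acts by $v_i\mapsto v_{i^g}$, $u_i\mapsto u_{i^{g'}}$. $G^+$ denotes the index-two subgroup of $G$ preserving each part. -}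

module Defs where

open import Data.Nat using (ℕ; zero; suc; s≤s; z≤n; _+_; _∸_; _≤_; _<_; _%_)
open import Data.Fin using (Fin; fromℕ<) renaming (_<?_ to _<ᶠ?_)
open import Data.Fin.Permutation using (Permutation′; transpose; _⟨$⟩ʳ_)
open import Data.Nat.Properties using (≤-trans)
open import Data.List using (List; length; filter; allFin; cartesianProduct)
open import Data.Product using (Σ; ∃; ∃-syntax; _×_; _,_; proj₁; proj₂)
open import Data.Sum using (_⊎_; inj₁; inj₂)
open import Data.Sum.Function.Propositional using (_⊎-↔_)
open import Data.Unit using (⊤)
open import Data.Empty using (⊥)
open import Function using (_↔_; Inverse; Surjective)
open import Function.Properties.Inverse using (↔-refl; ↔-sym; ↔-trans)
open import Relation.Binary.PropositionalEquality using (_≡_)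
open import Relation.Nullary.Decidable using (_×-dec_)

Perm : Set → Set
Perm X = X ↔ X

app : {X : Set} → Perm X → X → X
app σ = Inverse.to σ

_≈ₚ_ : {X : Set} → Perm X → Perm X → Set
σ ≈ₚ τ = ∀ x → app σ x ≡ app τ x

idP : {X : Set} → Perm X
idP = ↔-refl

-- product "first σ, then τ"
_·_ : {X : Set} → Perm X → Perm X → Perm X
σ · τ = ↔-trans σ τ

invP : {X : Set} → Perm X → Perm X
invP = ↔-sym

inversions : {n : ℕ} → Permutation′ n → ℕ
inversions {n} σ =
  length (filter (λ p → (proj₁ p <ᶠ? proj₂ p) ×-dec ((σ ⟨$⟩ʳ proj₂ p) <ᶠ? (σ ⟨$⟩ʳ proj₁ p)))
                 (cartesianProduct (allFin n) (allFin n)))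

IsEven : {n : ℕ} → Permutation′ n → Set
IsEven σ = inversions σ % 2 ≡ 0

-- The graph Γ = K_{n,n}: vertices inj₁ i = v_i (part Δ), inj₂ i = u_i (part Δ')

V : ℕ → Set
V n = Fin n ⊎ Fin n

Adj : {n : ℕ} → V n → V n → Set
Adj (inj₁ _) (inj₁ _) = ⊥
Adj (inj₁ _) (inj₂ _) = ⊤
Adj (inj₂ _) (inj₁ _) = ⊤
Adj (inj₂ _) (inj₂ _) = ⊥

IsAut : {n : ℕ} → Perm (V n) → Set
IsAut σ = ∀ x y → (Adj x y → Adj (app σ x) (app σ y)) × (Adj (app σ x) (app σ y) → Adj x y)

pair : {n : ℕ} → Permutation′ n → Permutation′ n → Perm (V n)
pair g g' = g ⊎-↔ g'

PreservesParts : {n : ℕ} → Perm (V n) → Set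
PreservesParts {n} σ =
  (∀ i → ∃[ j ] app σ (inj₁ i) ≡ inj₁ j) × (∀ i → ∃[ j ] app σ (inj₂ i) ≡ inj₂ j)

record IsSubgroup {X : Set} (G : Perm X → Set) : Set₁ where
  field
    resp  : ∀ {σ τ} → σ ≈ₚ τ → G σ → G τ
    hasId : G idP
    mul   : ∀ {σ τ} → G σ → G τ → G (σ · τ)
    inv   : ∀ {σ} → G σ → G (invP σ)

data Gen {X : Set} (S : Perm X → Set) : Perm X → Set where
  gen   : ∀ {σ} → S σ → Gen S σ
  gid   : Gen S idP
  gmul  : ∀ {σ τ} → Gen S σ → Gen S τ → Gen S (σ · τ)
  ginv  : ∀ {σ} → Gen S σ → Gen S (invP σ)
  gresp : ∀ {σ τ} → σ ≈ₚ τ → Gen S σ → Gen S τ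

_≐_ : {X : Set} → (Perm X → Set) → (Perm X → Set) → Set
A ≐ B = ∀ σ → (A σ → B σ) × (B σ → A σ)

AltAlt : (n : ℕ) → Perm (V n) → Set
AltAlt n σ = ∃[ g ] ∃[ g' ] IsEven g × IsEven g' × (pair g g' ≈ₚ σ)

SymSym : (n : ℕ) → Perm (V n) → Set
SymSym n σ = ∃[ g ] ∃[ g' ] (pair g g' ≈ₚ σ)

-- the transposition (1,2) of {1,…,n}, i.e. swapping the first two points
t12 : {n : ℕ} → 2 ≤ n → Permutation′ n
t12 {n} h = transpose (fromℕ< {0} {n} (≤-trans (s≤s z≤n) h)) (fromℕ< {1} {n} h)

AltAltT : (n : ℕ) → 2 ≤ n → Perm (V n) → Set
AltAltT n h = Gen (λ σ → AltAlt n σ ⊎ (pair (t12 h) (t12 h) ≈ₚ σ))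

Plus : {n : ℕ} → (Perm (V n) → Set) → Perm (V n) → Set
Plus G σ = G σ × PreservesParts σ

Transitive : {n : ℕ} → (Perm (V n) → Set) → Set
Transitive {n} G = ∀ (x y : V n) → ∃[ σ ] G σ × (app σ x ≡ y)

-- a partition of V into k (nonempty) parts, given by a surjection onto Fin k,
-- such that the intersection of the setwise stabilisers in G of the parts is trivial
Distinguishes : {n : ℕ} → (Perm (V n) → Set) → ℕ → Set
Distinguishes {n} G k =
  Σ (V n → Fin k) λ c → Surjective _≡_ _≡_ c ×
    (∀ σ → G σ → (∀ x → c (app σ x) ≡ c x) → σ ≈ₚ idP)

DistNumberIs : {n : ℕ} → (Perm (V n) → Set) → ℕ → Set
DistNumberIs G d = Distinguishes G d × (∀ k → Distinguishes G k → d ≤ k)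

{-# OPTIONS --safe #-}

-- Part-preserving automorphisms of K_{n,n} are pairs (g, g′) ∈ Sym(n) × Sym(n). A colouring of a
-- part that is injective except on one merged pair {b, c} is preserved there only by the identity
-- and the transposition (b c), and parity excludes the latter whenever G⁺ forces even parities
-- (Alt(n) × Alt(n)) or equal parities (⟨Alt(n) × Alt(n), ((1,2),(1,2))⟩, whose elements are
-- exactly the pairs of equal parity). This gives distinguishing colourings with n − 1, n and
-- n + 1 colours, the placement of colour 0 ruling out part swaps. Conversely, with fewer colours
-- the pigeonhole principle produces colour-preserving transpositions whose products lie in G⁺,
-- or, for Sym(n) × Sym(n) with both parts coloured bijectively, a colour-matching part swap,
-- which lies in G because G is transitive. Parity is that of the inversion count; it is additive
-- modulo 2 because a ∘ b inverts a pair exactly when one of b and a (at the image pair) does.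

module Submission where

open import Defs
open import Data.Nat.Properties using (+-*-semiring)
open import Algebra.Properties.Semiring.Sum +-*-semiring using (sum; sum-syntax; ∑-comm; ∑-permute; ∑-distrib-+; sum-cong-≗; sum-replicate-zero)
open import Data.Bool using (true; false)
open import Data.Fin using (Fin; zero; suc; toℕ; fromℕ<; pinch; punchIn; punchOut) renaming (_<_ to _<ᶠ_; _<?_ to _<ᶠ?_)
import Data.Fin.Properties as Finₚ
import Data.Fin.Permutation.Components as PC
open import Data.Fin.Permutation using (Permutation′; transpose; _⟨$⟩ʳ_; _⟨$⟩ˡ_; _≈_; _∘ₚ_; id; flip; inverseˡ; inverseʳ)
open import Data.List using ([]; _∷_; _++_; length; filter; tabulate; cartesianProduct; map)
open import Data.List.Properties using (filter-++; length-++; map-tabulate)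
open import Data.Nat using (ℕ; zero; suc; _+_; _*_; _∸_; _%_; _<_; _≤_; s≤s; z≤n)
open import Data.Nat.DivMod using (%-distribˡ-+; [m+kn]%n≡m%n; m%n%n≡m%n; m%n<n)
open import Data.Nat.Properties using (+-comm; +-identityʳ; *-distribˡ-+; *-distribʳ-+; *-cancelˡ-≡; *-zeroʳ; ≤-trans; ≤-pred; ≮⇒≥; m<n⇒m<1+n; 0≢1+n; 1+n≰n)
open import Data.Nat.Tactic.RingSolver using (solve)
open import Data.Product using (∃-syntax; _×_; _,_; proj₁; proj₂)
open import Data.Sum using (_⊎_; inj₁; inj₂)
open import Data.Sum.Properties using (inj₁-injective; inj₂-injective)
open import Data.Unit using (tt)
open import Function using (_∘_; _↔_; Inverse; Injection; Injective; Surjective; mk↔ₛ′)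
open import Function.Properties.Inverse using (↔⇒↣)
open import Relation.Binary using (tri<; tri≈; tri>)
open import Relation.Binary.PropositionalEquality
open import Relation.Nullary using (Dec; yes; no; _because_; ¬_; ¬?; contradiction)
open import Relation.Nullary.Decidable using (_×-dec_; dec-true; dec-false; decidable-stable)
open import Relation.Unary using (Pred; Decidable)
open import Level using (0ℓ)

-- Inversion counts

↔-injective : {A : Set} (σ : A ↔ A) → Injective _≡_ _≡_ (Inverse.to σ)
↔-injective σ = Injection.injective (↔⇒↣ σ)

iverson : {A : Set} → Dec A → ℕ
iverson (true because _) = 1
iverson (false because _) = 0

iverson-×-dec : {A B : Set} (a : Dec A) (b : Dec B) → iverson (a ×-dec b) ≡ iverson a * iverson b
iverson-×-dec (true because _) (true because _) = refl
iverson-×-dec (true because _) (false because _) = refl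
iverson-×-dec (false because _) _ = refl

module _ {A : Set} {P : Pred A 0ℓ} (P? : Decidable P) where

  length-filter-tabulate : ∀ {n} (f : Fin n → A) →
    length (filter P? (tabulate f)) ≡ ∑[ i < n ] iverson (P? (f i))
  length-filter-tabulate {zero} f = refl
  length-filter-tabulate {suc n} f with P? (f zero)
  ... | true because _ = cong suc (length-filter-tabulate (f ∘ suc))
  ... | false because _ = length-filter-tabulate (f ∘ suc)

module _ {B C : Set} {P : Pred (B × C) 0ℓ} (P? : Decidable P) where

  length-filter-cartesianProduct : ∀ {m n} (f : Fin m → B) (g : Fin n → C) →
    length (filter P? (cartesianProduct (tabulate f) (tabulate g))) ≡
      ∑[ i < m ] ∑[ j < n ] iverson (P? (f i , g j))
  length-filter-cartesianProduct {zero} f g = refl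
  length-filter-cartesianProduct {suc m} f g = begin
    length (filter P? (row ++ rest))                 ≡⟨ cong length (filter-++ P? row rest) ⟩
    length (filter P? row ++ filter P? rest)         ≡⟨ length-++ (filter P? row) ⟩
    length (filter P? row) + length (filter P? rest)
      ≡⟨ cong₂ _+_ (cong (length ∘ filter P?) (map-tabulate g (f zero ,_)))
                   (length-filter-cartesianProduct (f ∘ suc) g) ⟩
    length (filter P? (tabulate (λ j → f zero , g j))) + _
      ≡⟨ cong (_+ _) (length-filter-tabulate P? (λ j → f zero , g j)) ⟩
    _ ∎
    where
    open ≡-Reasoning
    row = map (f zero ,_) (tabulate g)
    rest = cartesianProduct (tabulate (f ∘ suc)) (tabulate g)

⟦_<_⟧ : ∀ {n} → Fin n → Fin n → ℕ
⟦ i < j ⟧ = iverson (i <ᶠ? j)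

module _ {n : ℕ} where

  ⟦<⟧-yes : {i j : Fin n} → i <ᶠ j → ⟦ i < j ⟧ ≡ 1
  ⟦<⟧-yes {i} {j} i<j with i <ᶠ? j
  ... | yes _ = refl
  ... | no i≮j = contradiction i<j i≮j

  ⟦<⟧-no : {i j : Fin n} → ¬ i <ᶠ j → ⟦ i < j ⟧ ≡ 0
  ⟦<⟧-no {i} {j} i≮j with i <ᶠ? j
  ... | yes i<j = contradiction i<j i≮j
  ... | no _ = refl

  ⟦<⟧-irrefl : (i : Fin n) → ⟦ i < i ⟧ ≡ 0
  ⟦<⟧-irrefl i = ⟦<⟧-no (Finₚ.<-irrefl refl)

  ⟦<⟧-total : {i j : Fin n} → i ≢ j → ⟦ i < j ⟧ + ⟦ j < i ⟧ ≡ 1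
  ⟦<⟧-total {i} {j} i≢j with Finₚ.<-cmp i j
  ... | tri< i<j _ j≮i rewrite ⟦<⟧-yes i<j | ⟦<⟧-no j≮i = refl
  ... | tri≈ _ i≡j _ = contradiction i≡j i≢j
  ... | tri> i≮j _ j<i rewrite ⟦<⟧-no i≮j | ⟦<⟧-yes j<i = refl

  ⟦<⟧-asym : (i j : Fin n) → ⟦ i < j ⟧ * ⟦ j < i ⟧ ≡ 0
  ⟦<⟧-asym i j with i <ᶠ? j
  ... | yes i<j = cong (_+ 0) (⟦<⟧-no (Finₚ.<-asym i<j))
  ... | no _ = refl

  ∑² : (Fin n → Fin n → ℕ) → ℕ
  ∑² f = ∑[ i < n ] ∑[ j < n ] f i j

  ∑< : (Fin n → Fin n → ℕ) → ℕ
  ∑< f = ∑² (λ i j → ⟦ i < j ⟧ * f i j)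

  ∑²-cong : {f g : Fin n → Fin n → ℕ} → (∀ i j → f i j ≡ g i j) → ∑² f ≡ ∑² g
  ∑²-cong f≗g = sum-cong-≗ (λ i → sum-cong-≗ (f≗g i))

  ∑²-+ : (f g : Fin n → Fin n → ℕ) → ∑² (λ i j → f i j + g i j) ≡ ∑² f + ∑² g
  ∑²-+ f g =
    trans (sum-cong-≗ (λ i → ∑-distrib-+ (f i) (g i))) (∑-distrib-+ (λ i → sum (f i)) (λ i → sum (g i)))

  ∑²-permute : (π : Permutation′ n) (f : Fin n → Fin n → ℕ) →
    ∑² (λ i j → f (π ⟨$⟩ʳ i) (π ⟨$⟩ʳ j)) ≡ ∑² f
  ∑²-permute π f =
    sym (trans (∑-permute (λ x → sum (f x)) π) (sum-cong-≗ (λ i → ∑-permute (f (π ⟨$⟩ʳ i)) π)))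

  ∑<-cong : {f g : Fin n → Fin n → ℕ} → (∀ {i j} → i <ᶠ j → f i j ≡ g i j) → ∑< f ≡ ∑< g
  ∑<-cong {f} {g} f≗g = ∑²-cong pointwise
    where
    pointwise : ∀ i j → ⟦ i < j ⟧ * f i j ≡ ⟦ i < j ⟧ * g i j
    pointwise i j with i <ᶠ? j
    ... | yes i<j = cong (_+ 0) (f≗g i<j)
    ... | no _ = refl

  ∑<-+ : (f g : Fin n → Fin n → ℕ) → ∑< (λ i j → f i j + g i j) ≡ ∑< f + ∑< g
  ∑<-+ f g = trans (∑²-cong (λ i j → *-distribˡ-+ ⟦ i < j ⟧ (f i j) (g i j))) (∑²-+ _ _)

  ∑²≡∑<+∑< : (Q : Fin n → Fin n → ℕ) → (∀ i j → Q i j ≡ Q j i) → (∀ i → Q i i ≡ 0) →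
    ∑² Q ≡ ∑< Q + ∑< Q
  ∑²≡∑<+∑< Q Q-sym Q-diag = begin
    ∑² Q                                                   ≡⟨ ∑²-cong split ⟩
    ∑² (λ i j → ⟦ i < j ⟧ * Q i j + ⟦ j < i ⟧ * Q j i)     ≡⟨ ∑²-+ _ _ ⟩
    ∑< Q + ∑² (λ i j → ⟦ j < i ⟧ * Q j i)
      ≡⟨ cong (∑< Q +_) (∑-comm (λ i j → ⟦ j < i ⟧ * Q j i)) ⟩
    ∑< Q + ∑< Q                                            ∎
    where
    open ≡-Reasoning
    split : ∀ i j → Q i j ≡ ⟦ i < j ⟧ * Q i j + ⟦ j < i ⟧ * Q j i
    split i j with i Finₚ.≟ j
    ... | yes refl rewrite Q-diag i | *-zeroʳ ⟦ i < i ⟧ = refl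
    ... | no i≢j rewrite Q-sym j i | sym (*-distribʳ-+ (Q i j) ⟦ i < j ⟧ ⟦ j < i ⟧) | ⟦<⟧-total i≢j =
      sym (+-identityʳ (Q i j))

  ∑<-permute : (π : Permutation′ n) (Q : Fin n → Fin n → ℕ) →
    (∀ i j → Q i j ≡ Q j i) → (∀ i → Q i i ≡ 0) →
    ∑< (λ i j → Q (π ⟨$⟩ʳ i) (π ⟨$⟩ʳ j)) ≡ ∑< Q
  ∑<-permute π Q Q-sym Q-diag = double-injective (begin
    ∑< Qπ + ∑< Qπ ≡⟨ sym (∑²≡∑<+∑< Qπ (λ i j → Q-sym _ _) (λ i → Q-diag _)) ⟩
    ∑² Qπ        ≡⟨ ∑²-permute π Q ⟩
    ∑² Q          ≡⟨ ∑²≡∑<+∑< Q Q-sym Q-diag ⟩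
    ∑< Q + ∑< Q   ∎)
    where
    open ≡-Reasoning
    Qπ : Fin n → Fin n → ℕ
    Qπ i j = Q (π ⟨$⟩ʳ i) (π ⟨$⟩ʳ j)
    double-injective : ∀ {a b} → a + a ≡ b + b → a ≡ b
    double-injective {a} {b} eq =
      *-cancelˡ-≡ a b 2 (trans (cong (a +_) (+-identityʳ a)) (trans eq (sym (cong (b +_) (+-identityʳ b)))))

sum≡0 : ∀ {n} {f : Fin n → ℕ} → (∀ i → f i ≡ 0) → sum f ≡ 0
sum≡0 {n} f≗0 = trans (sum-cong-≗ {n} f≗0) (sum-replicate-zero n)

inversionCount : ∀ {n} → (Fin n → Fin n) → ℕ
inversionCount f = ∑< (λ i j → ⟦ f j < f i ⟧)

inversions≡inversionCount : ∀ {n} (σ : Permutation′ n) → inversions σ ≡ inversionCount (σ ⟨$⟩ʳ_)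
inversions≡inversionCount σ =
  trans (length-filter-cartesianProduct inverted? (λ i → i) (λ j → j))
        (∑²-cong (λ i j → iverson-×-dec (i <ᶠ? j) ((σ ⟨$⟩ʳ j) <ᶠ? (σ ⟨$⟩ʳ i))))
  where
  inverted? : (p : Fin _ × Fin _) → Dec (proj₁ p <ᶠ proj₂ p × σ ⟨$⟩ʳ proj₂ p <ᶠ σ ⟨$⟩ʳ proj₁ p)
  inverted? (i , j) = (i <ᶠ? j) ×-dec ((σ ⟨$⟩ʳ j) <ᶠ? (σ ⟨$⟩ʳ i))

-- For i < j, put X = b i and Y = b j: the pair (i, j) is inverted by a ∘ b iff exactly one of
-- "b inverts (i, j)" and "a inverts {X, Y}" holds; r counts the pairs where both hold.
inversionCount-∘ : ∀ {n} (a b : Permutation′ n) →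
  ∃[ r ] inversionCount ((a ⟨$⟩ʳ_) ∘ (b ⟨$⟩ʳ_)) + (r + r) ≡
         inversionCount (b ⟨$⟩ʳ_) + inversionCount (a ⟨$⟩ʳ_)
inversionCount-∘ {n} a b = ∑< both , (begin
  ∑< (λ i j → ⟦ A (B j) < A (B i) ⟧) + (∑< both + ∑< both)
    ≡⟨ cong (inversionCount (A ∘ B) +_) (sym (∑<-+ both both)) ⟩
  ∑< (λ i j → ⟦ A (B j) < A (B i) ⟧) + ∑< (λ i j → both i j + both i j)
    ≡⟨ sym (∑<-+ (λ i j → ⟦ A (B j) < A (B i) ⟧) (λ i j → both i j + both i j)) ⟩
  ∑< (λ i j → ⟦ A (B j) < A (B i) ⟧ + (both i j + both i j))
    ≡⟨ ∑<-cong count-pair ⟩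
  ∑< (λ i j → ⟦ B j < B i ⟧ + invertedBy-a (B i) (B j))
    ≡⟨ ∑<-+ (λ i j → ⟦ B j < B i ⟧) (λ i j → invertedBy-a (B i) (B j)) ⟩
  inversionCount B + ∑< (λ i j → invertedBy-a (B i) (B j))
    ≡⟨ cong (inversionCount B +_) (∑<-permute b invertedBy-a invertedBy-a-sym invertedBy-a-diag) ⟩
  inversionCount B + ∑< invertedBy-a
    ≡⟨ cong (inversionCount B +_) (∑<-cong invertedBy-a-below) ⟩
  inversionCount B + inversionCount A ∎)
  where
  open ≡-Reasoning
  A B : Fin n → Fin n
  A = a ⟨$⟩ʳ_
  B = b ⟨$⟩ʳ_

  invertedBy-a : Fin n → Fin n → ℕ
  invertedBy-a X Y = ⟦ X < Y ⟧ * ⟦ A Y < A X ⟧ + ⟦ Y < X ⟧ * ⟦ A X < A Y ⟧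

  both : Fin n → Fin n → ℕ
  both i j = ⟦ B j < B i ⟧ * ⟦ A (B i) < A (B j) ⟧

  invertedBy-a-sym : ∀ X Y → invertedBy-a X Y ≡ invertedBy-a Y X
  invertedBy-a-sym X Y = +-comm (⟦ X < Y ⟧ * ⟦ A Y < A X ⟧) _

  invertedBy-a-diag : ∀ X → invertedBy-a X X ≡ 0
  invertedBy-a-diag X rewrite ⟦<⟧-irrefl X = refl

  invertedBy-a-below : ∀ {X Y} → X <ᶠ Y → invertedBy-a X Y ≡ ⟦ A Y < A X ⟧
  invertedBy-a-below {X} {Y} X<Y
    rewrite ⟦<⟧-yes X<Y | ⟦<⟧-no (Finₚ.<-asym X<Y) = trans (+-identityʳ _) (+-identityʳ _)

  bit-identity : ∀ u w p q → u + w ≡ 1 → p + q ≡ 1 → p + (w * q + w * q) ≡ w + (u * p + w * q)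
  bit-identity zero .1 zero .1 refl refl = refl
  bit-identity zero .1 (suc zero) .0 refl refl = refl
  bit-identity (suc zero) .0 zero .1 refl refl = refl
  bit-identity (suc zero) .0 (suc zero) .0 refl refl = refl
  bit-identity _ _ (suc (suc _)) _ _ ()
  bit-identity (suc (suc _)) _ _ _ () _

  count-pair : ∀ {i j} → i <ᶠ j →
    ⟦ A (B j) < A (B i) ⟧ + (both i j + both i j) ≡ ⟦ B j < B i ⟧ + invertedBy-a (B i) (B j)
  count-pair {i} {j} i<j =
    bit-identity ⟦ B i < B j ⟧ ⟦ B j < B i ⟧ ⟦ A (B j) < A (B i) ⟧ ⟦ A (B i) < A (B j) ⟧
                 (⟦<⟧-total Bi≢Bj) (⟦<⟧-total (Bi≢Bj ∘ sym ∘ ↔-injective a))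
    where
    Bi≢Bj : B i ≢ B j
    Bi≢Bj = Finₚ.<⇒≢ i<j ∘ ↔-injective b

+-double-%2 : ∀ m r → (m + (r + r)) % 2 ≡ m % 2
+-double-%2 m r = trans (cong (λ k → (m + k) % 2) (solve (r ∷ []))) ([m+kn]%n≡m%n m r 2)

parity-cancelˡ : ∀ a b c → (a + b) % 2 ≡ (a + c) % 2 → b % 2 ≡ c % 2
parity-cancelˡ a b c eq = begin
  b % 2                       ≡⟨ sym (+-double-%2 b a) ⟩
  (b + (a + a)) % 2           ≡⟨ cong (_% 2) (regroup b) ⟩
  (a + (a + b)) % 2           ≡⟨ %-distribˡ-+ a (a + b) 2 ⟩
  (a % 2 + (a + b) % 2) % 2   ≡⟨ cong (λ x → (a % 2 + x) % 2) eq ⟩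
  (a % 2 + (a + c) % 2) % 2   ≡⟨ sym (%-distribˡ-+ a (a + c) 2) ⟩
  (a + (a + c)) % 2           ≡⟨ cong (_% 2) (sym (regroup c)) ⟩
  (c + (a + a)) % 2           ≡⟨ +-double-%2 c a ⟩
  c % 2                       ∎
  where
  open ≡-Reasoning
  regroup : ∀ x → x + (a + a) ≡ a + (a + x)
  regroup x = solve (a ∷ x ∷ [])

%2≡0⊎%2≡1 : ∀ m → m % 2 ≡ 0 ⊎ m % 2 ≡ 1
%2≡0⊎%2≡1 m with m % 2 | m%n<n m 2
... | 0 | _ = inj₁ refl
... | 1 | _ = inj₂ refl
... | suc (suc _) | s≤s (s≤s ())

module _ {n : ℕ} where

  inversions-cong : (g h : Permutation′ n) → g ≈ h → inversions g ≡ inversions h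
  inversions-cong g h g≈h = begin
    inversions g                    ≡⟨ inversions≡inversionCount g ⟩
    inversionCount (g ⟨$⟩ʳ_)
      ≡⟨ ∑²-cong (λ i j → cong₂ (λ x y → ⟦ i < j ⟧ * ⟦ x < y ⟧) (g≈h j) (g≈h i)) ⟩
    inversionCount (h ⟨$⟩ʳ_)        ≡⟨ sym (inversions≡inversionCount h) ⟩
    inversions h                    ∎
    where open ≡-Reasoning

  inversions-id : inversions (id {n}) ≡ 0
  inversions-id = trans (inversions≡inversionCount (id {n})) (sum≡0 {n} (λ i → sum≡0 {n} (⟦<⟧-asym i)))

  inversions-∘ₚ : (g h : Permutation′ n) → inversions (g ∘ₚ h) % 2 ≡ (inversions g + inversions h) % 2
  inversions-∘ₚ g h with r , eq ← inversionCount-∘ h g = begin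
    inversions (g ∘ₚ h) % 2                         ≡⟨ cong (_% 2) (inversions≡inversionCount (g ∘ₚ h)) ⟩
    inversionCount (H ∘ G) % 2                      ≡⟨ sym (+-double-%2 (inversionCount (H ∘ G)) r) ⟩
    (inversionCount (H ∘ G) + (r + r)) % 2          ≡⟨ cong (_% 2) eq ⟩
    (inversionCount G + inversionCount H) % 2
      ≡⟨ cong₂ (λ x y → (x + y) % 2) (inversions≡inversionCount g) (inversions≡inversionCount h) ⟨
    (inversions g + inversions h) % 2               ∎
    where
    open ≡-Reasoning
    G H : Fin n → Fin n
    G = g ⟨$⟩ʳ_
    H = h ⟨$⟩ʳ_

  inversions-flip : (g : Permutation′ n) → inversions (flip g) % 2 ≡ inversions g % 2
  inversions-flip g = parity-cancelˡ (inversions g) (inversions (flip g)) (inversions g) (begin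
    (inversions g + inversions (flip g)) % 2  ≡⟨ inversions-∘ₚ g (flip g) ⟨
    inversions (g ∘ₚ flip g) % 2
      ≡⟨ cong (_% 2) (trans (inversions-cong (g ∘ₚ flip g) id (λ _ → inverseˡ g)) inversions-id) ⟩
    0                                          ≡⟨ +-double-%2 0 (inversions g) ⟨
    (inversions g + inversions g) % 2          ∎)
    where open ≡-Reasoning

  inversions-conj : (π x y : Permutation′ n) → π ∘ₚ x ≈ y ∘ₚ π → inversions x % 2 ≡ inversions y % 2
  inversions-conj π x y πx≈yπ = parity-cancelˡ (inversions π) (inversions x) (inversions y) (begin
    (inversions π + inversions x) % 2  ≡⟨ inversions-∘ₚ π x ⟨
    inversions (π ∘ₚ x) % 2            ≡⟨ cong (_% 2) (inversions-cong (π ∘ₚ x) (y ∘ₚ π) πx≈yπ) ⟩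
    inversions (y ∘ₚ π) % 2            ≡⟨ inversions-∘ₚ y π ⟩
    (inversions y + inversions π) % 2  ≡⟨ cong (_% 2) (+-comm (inversions y) (inversions π)) ⟩
    (inversions π + inversions y) % 2  ∎)
    where open ≡-Reasoning

inversions-∘ₚ-even : ∀ {n} (g h : Permutation′ n) → IsEven g → inversions (g ∘ₚ h) % 2 ≡ inversions h % 2
inversions-∘ₚ-even g h g-even = begin
  inversions (g ∘ₚ h) % 2                   ≡⟨ inversions-∘ₚ g h ⟩
  (inversions g + inversions h) % 2         ≡⟨ %-distribˡ-+ (inversions g) (inversions h) 2 ⟩
  (inversions g % 2 + inversions h % 2) % 2 ≡⟨ cong (λ p → (p + inversions h % 2) % 2) g-even ⟩
  inversions h % 2 % 2                      ≡⟨ m%n%n≡m%n (inversions h) 2 ⟩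
  inversions h % 2                          ∎
  where open ≡-Reasoning

id-even : ∀ {n} → IsEven (id {n})
id-even {n} = cong (_% 2) (inversions-id {n})

odd∘ₚodd-even : ∀ {n} (g h : Permutation′ n) → inversions g % 2 ≡ 1 → inversions h % 2 ≡ 1 → IsEven (g ∘ₚ h)
odd∘ₚodd-even g h g-odd h-odd = trans (inversions-∘ₚ g h)
  (trans (%-distribˡ-+ (inversions g) (inversions h) 2) (cong₂ (λ x y → (x + y) % 2) g-odd h-odd))

module _ {n : ℕ} where

  transpose-matchˡ : (i j : Fin n) → PC.transpose i j i ≡ j
  transpose-matchˡ i j rewrite dec-true (i Finₚ.≟ i) refl = refl

  transpose-matchʳ : (i j : Fin n) → PC.transpose i j j ≡ i
  transpose-matchʳ i j with j Finₚ.≟ i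
  ... | yes refl = refl
  ... | no _ rewrite dec-true (j Finₚ.≟ j) refl = refl

  transpose-other : {i j k : Fin n} → k ≢ i → k ≢ j → PC.transpose i j k ≡ k
  transpose-other {i} {j} {k} k≢i k≢j rewrite dec-false (k Finₚ.≟ i) k≢i | dec-false (k Finₚ.≟ j) k≢j = refl

  transpose-conj : (π : Permutation′ n) (a b : Fin n) →
    π ∘ₚ transpose (π ⟨$⟩ʳ a) (π ⟨$⟩ʳ b) ≈ transpose a b ∘ₚ π
  transpose-conj π a b k = by-cases (k Finₚ.≟ a) (k Finₚ.≟ b)
    where
    π[_] = π ⟨$⟩ʳ_
    by-cases : Dec (k ≡ a) → Dec (k ≡ b) → PC.transpose π[ a ] π[ b ] π[ k ] ≡ π[ PC.transpose a b k ]
    by-cases (yes refl) _ = trans (transpose-matchˡ π[ k ] π[ b ]) (cong π[_] (sym (transpose-matchˡ k b)))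
    by-cases (no _) (yes refl) = trans (transpose-matchʳ π[ a ] π[ k ]) (cong π[_] (sym (transpose-matchʳ a k)))
    by-cases (no k≢a) (no k≢b) = trans (transpose-other (k≢a ∘ ↔-injective π) (k≢b ∘ ↔-injective π))
                                       (cong π[_] (sym (transpose-other k≢a k≢b)))

-- Only the pair (0, 1) is inverted.
inversions-transpose01 : ∀ m → inversions (transpose {suc (suc m)} zero (suc zero)) ≡ 1
inversions-transpose01 m = trans (inversions≡inversionCount t) (cong₂ _+_ row₀ (cong₂ _+_ row₁ rows₂₊))
  where
  t = transpose {suc (suc m)} zero (suc zero)
  T = t ⟨$⟩ʳ_
  row : Fin (suc (suc m)) → ℕ
  row i = ∑[ j < suc (suc m) ] (⟦ i < j ⟧ * ⟦ T j < T i ⟧)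
  row₀ : row zero ≡ 1
  row₀ = cong suc (sum≡0 {m} (λ _ → refl))
  row₁ : row (suc zero) ≡ 0
  row₁ = sum≡0 {suc (suc m)} (λ _ → refl)
  rows₂₊ : ∑[ i < m ] row (suc (suc i)) ≡ 0
  rows₂₊ = sum≡0 {m} (λ i → sum≡0 {m} (λ j → ⟦<⟧-asym (suc (suc i)) (suc (suc j))))

inversions-transpose-relabel : ∀ {n} (π : Permutation′ n) (a′ b′ : Fin n) {a b : Fin n} →
  π ⟨$⟩ʳ a′ ≡ a → π ⟨$⟩ʳ b′ ≡ b → inversions (transpose a b) % 2 ≡ inversions (transpose a′ b′) % 2
inversions-transpose-relabel π a′ b′ refl refl =
  inversions-conj π (transpose (π ⟨$⟩ʳ a′) (π ⟨$⟩ʳ b′)) (transpose a′ b′) (transpose-conj π a′ b′)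

-- Relabelling by (0 a) and then by (1 c) reduces every transposition to (0 1).
transpose-odd : ∀ {n} {a b : Fin n} → a ≢ b → inversions (transpose a b) % 2 ≡ 1
transpose-odd {suc zero} {zero} {zero} a≢b = contradiction refl a≢b
transpose-odd {suc (suc m)} {a} {b} a≢b =
  trans (inversions-transpose-relabel σ zero b′ (transpose-matchˡ zero a) (inverseʳ σ)) (transpose₀-odd b′≢0)
  where
  σ = transpose zero a
  b′ = σ ⟨$⟩ˡ b
  b′≢0 : b′ ≢ zero
  b′≢0 b′≡0 = a≢b (trans (sym (transpose-matchˡ zero a)) (trans (cong (σ ⟨$⟩ʳ_) (sym b′≡0)) (inverseʳ σ)))
  transpose₀-odd : ∀ {c} → c ≢ zero → inversions (transpose zero c) % 2 ≡ 1
  transpose₀-odd {c} c≢0 = trans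
    (inversions-transpose-relabel (transpose (suc zero) c) zero (suc zero)
       (transpose-other {i = suc zero} (λ ()) (c≢0 ∘ sym)) (transpose-matchˡ (suc zero) c))
    (cong (_% 2) (inversions-transpose01 m))

transpose≉id : ∀ {n} {i j : Fin n} → i ≢ j → ¬ transpose i j ≈ id
transpose≉id {i = i} {j} i≢j t≈id = i≢j (sym (trans (sym (transpose-matchˡ i j)) (t≈id i)))

module _ {n : ℕ} {A : Set} where

  transpose-preserves : (κ : Fin n → A) {a b : Fin n} → κ a ≡ κ b → ∀ x → κ (PC.transpose a b x) ≡ κ x
  transpose-preserves κ {a} {b} κa≡κb x = by-cases (x Finₚ.≟ a) (x Finₚ.≟ b)
    where
    by-cases : Dec (x ≡ a) → Dec (x ≡ b) → κ (PC.transpose a b x) ≡ κ x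
    by-cases (yes refl) _ = trans (cong κ (transpose-matchˡ x b)) (sym κa≡κb)
    by-cases (no _) (yes refl) = trans (cong κ (transpose-matchʳ a x)) κa≡κb
    by-cases (no x≢a) (no x≢b) = cong κ (transpose-other x≢a x≢b)

  InjectiveAwayFrom : (Fin n → A) → Fin n → Set
  InjectiveAwayFrom κ b = ∀ {x y} → x ≢ b → y ≢ b → κ x ≡ κ y → x ≡ y

  module _ {κ : Fin n → A} {b : Fin n} (κ-inj : InjectiveAwayFrom κ b) where

    fixes-injectiveAwayFrom⇒≈id : (g : Permutation′ n) → (∀ i → κ (g ⟨$⟩ʳ i) ≡ κ i) → g ⟨$⟩ʳ b ≡ b → g ≈ id
    fixes-injectiveAwayFrom⇒≈id g g-pres gb≡b i with i Finₚ.≟ b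
    ... | yes refl = gb≡b
    ... | no i≢b = κ-inj gi≢b i≢b (g-pres i)
      where
      gi≢b : g ⟨$⟩ʳ i ≢ b
      gi≢b gi≡b = i≢b (↔-injective g (trans gi≡b (sym gb≡b)))

    -- If g moves b to c then g followed by the transposition (b c) still preserves κ and fixes b,
    -- so g agrees with that transposition and is odd.
    even-injectiveAwayFrom⇒≈id : (g : Permutation′ n) → (∀ i → κ (g ⟨$⟩ʳ i) ≡ κ i) → IsEven g → g ≈ id
    even-injectiveAwayFrom⇒≈id g g-pres g-even with g ⟨$⟩ʳ b Finₚ.≟ b
    ... | yes gb≡b = fixes-injectiveAwayFrom⇒≈id g g-pres gb≡b
    ... | no gb≢b = contradiction (begin
        1                        ≡⟨ transpose-odd (gb≢b ∘ sym) ⟨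
        inversions t % 2         ≡⟨ inversions-∘ₚ-even g t g-even ⟨
        inversions (g ∘ₚ t) % 2  ≡⟨ cong (_% 2) (trans (inversions-cong (g ∘ₚ t) id h≈id) (inversions-id {n})) ⟩
        0                        ∎) (λ ())
      where
      open ≡-Reasoning
      t = transpose b (g ⟨$⟩ʳ b)
      h≈id : g ∘ₚ t ≈ id
      h≈id = fixes-injectiveAwayFrom⇒≈id (g ∘ₚ t)
        (λ i → trans (transpose-preserves κ (sym (g-pres b)) (g ⟨$⟩ʳ i)) (g-pres i))
        (transpose-matchʳ b (g ⟨$⟩ʳ b))

pinch-suc≡zero : ∀ {n} {i : Fin n} {j : Fin (suc (suc n))} → pinch (suc i) j ≡ zero → j ≡ zero
pinch-suc≡zero {j = zero} _ = refl

pinch-injectiveAwayFrom : ∀ {n} (i : Fin n) → InjectiveAwayFrom (pinch i) (suc i)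
pinch-injectiveAwayFrom i x≢ y≢ = Finₚ.pinch-injective (x≢ ∘ sym) (y≢ ∘ sym)

injective-or-collision : ∀ {n k} (f : Fin n → Fin k) → Injective _≡_ _≡_ f ⊎ ∃[ i ] ∃[ j ] i ≢ j × f i ≡ f j
injective-or-collision f with Finₚ.any? (λ i → Finₚ.any? (λ j → ¬? (i Finₚ.≟ j) ×-dec (f i Finₚ.≟ f j)))
... | yes (i , j , i≢j , fi≡fj) = inj₂ (i , j , i≢j , fi≡fj)
... | no no-collision = inj₁ λ {i} {j} fi≡fj →
  decidable-stable (i Finₚ.≟ j) (λ i≢j → no-collision (i , j , i≢j , fi≡fj))

-- A missed y could be punched out, injecting Fin n into Fin (k − 1).
injective⇒surjective : ∀ {n k} → k ≤ n → (f : Fin n → Fin k) → Injective _≡_ _≡_ f → ∀ y → ∃[ x ] f x ≡ y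
injective⇒surjective {k = suc _} k≤n f f-injective y with Finₚ.any? (λ x → f x Finₚ.≟ y)
... | yes hit = hit
... | no miss = contradiction (≤-trans k≤n (Finₚ.injective⇒≤ punchOut-injective)) 1+n≰n
  where
  y≢f : ∀ x → y ≢ f x
  y≢f x y≡fx = miss (x , sym y≡fx)
  punchOut-injective : Injective _≡_ _≡_ (λ x → punchOut (y≢f x))
  punchOut-injective {a} {b} eq = f-injective (Finₚ.punchOut-injective (y≢f a) (y≢f b) eq)

-- Automorphisms of K_{n,n}

module _ {n : ℕ} where

  SwapsParts : Perm (V n) → Set
  SwapsParts σ = (∀ i → ∃[ j ] app σ (inj₁ i) ≡ inj₂ j) × (∀ i → ∃[ j ] app σ (inj₂ i) ≡ inj₁ j)

  app-from : (σ : Perm (V n)) (x : V n) → app σ (Inverse.from σ x) ≡ x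
  app-from σ = Inverse.strictlyInverseˡ σ

  from-app : (σ : Perm (V n)) (x : V n) → Inverse.from σ (app σ x) ≡ x
  from-app σ = Inverse.strictlyInverseʳ σ

  private
    Adj-inj₁ : ∀ {j} (z : V n) → Adj (inj₁ j) z → ∃[ k ] z ≡ inj₂ k
    Adj-inj₁ (inj₂ k) _ = k , refl

    Adj-inj₂ : ∀ {j} (z : V n) → Adj (inj₂ j) z → ∃[ k ] z ≡ inj₁ k
    Adj-inj₂ (inj₁ k) _ = k , refl

  module _ (σ : Perm (V n)) (aut : IsAut σ) where

    private
      σ-adj : ∀ {x y} → Adj x y → Adj (app σ x) (app σ y)
      σ-adj {x} {y} = proj₁ (aut x y)

      opposite₁ : ∀ {x y j} → app σ x ≡ inj₁ j → Adj x y → ∃[ k ] app σ y ≡ inj₂ k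
      opposite₁ {y = y} σx≡v adj = Adj-inj₁ (app σ y) (subst (λ z → Adj z (app σ y)) σx≡v (σ-adj adj))

      opposite₂ : ∀ {x y j} → app σ x ≡ inj₂ j → Adj x y → ∃[ k ] app σ y ≡ inj₁ k
      opposite₂ {y = y} σx≡u adj = Adj-inj₂ (app σ y) (subst (λ z → Adj z (app σ y)) σx≡u (σ-adj adj))

    IsAut⇒PreservesParts₁ : ∀ {i j} → app σ (inj₁ i) ≡ inj₁ j → PreservesParts σ
    IsAut⇒PreservesParts₁ {i} σv≡v = onΔ , onΔ′
      where
      onΔ′ : ∀ k → ∃[ l ] app σ (inj₂ k) ≡ inj₂ l
      onΔ′ k = opposite₁ {inj₁ i} σv≡v tt
      onΔ : ∀ k → ∃[ l ] app σ (inj₁ k) ≡ inj₁ l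
      onΔ k = opposite₂ {inj₂ k} (proj₂ (onΔ′ k)) tt

    IsAut⇒PreservesParts₂ : ∀ {i j} → app σ (inj₂ i) ≡ inj₂ j → PreservesParts σ
    IsAut⇒PreservesParts₂ {i} σu≡u = onΔ , onΔ′
      where
      onΔ : ∀ k → ∃[ l ] app σ (inj₁ k) ≡ inj₁ l
      onΔ k = opposite₂ {inj₂ i} σu≡u tt
      onΔ′ : ∀ k → ∃[ l ] app σ (inj₂ k) ≡ inj₂ l
      onΔ′ k = opposite₁ {inj₁ k} (proj₂ (onΔ k)) tt

    IsAut⇒SwapsParts : ∀ {i j} → app σ (inj₁ i) ≡ inj₂ j → SwapsParts σ
    IsAut⇒SwapsParts {i} σv≡u = onΔ , onΔ′
      where
      onΔ′ : ∀ k → ∃[ l ] app σ (inj₂ k) ≡ inj₁ l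
      onΔ′ k = opposite₂ {inj₁ i} σv≡u tt
      onΔ : ∀ k → ∃[ l ] app σ (inj₁ k) ≡ inj₂ l
      onΔ k = opposite₁ {inj₂ k} (proj₂ (onΔ′ k)) tt

  SwapsParts-· : (σ τ : Perm (V n)) → SwapsParts σ → SwapsParts τ → PreservesParts (σ · τ)
  SwapsParts-· σ τ (σΔ , σΔ′) (τΔ , τΔ′) = onΔ , onΔ′
    where
    onΔ : ∀ i → ∃[ j ] app τ (app σ (inj₁ i)) ≡ inj₁ j
    onΔ i = let j , σv≡u = σΔ i ; k , τu≡v = τΔ′ j in k , trans (cong (app τ) σv≡u) τu≡v
    onΔ′ : ∀ i → ∃[ j ] app τ (app σ (inj₂ i)) ≡ inj₂ j
    onΔ′ i = let j , σu≡v = σΔ′ i ; k , τv≡u = τΔ j in k , trans (cong (app τ) σu≡v) τv≡u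

  PreservesParts-invP : (σ : Perm (V n)) → PreservesParts σ → PreservesParts (invP σ)
  PreservesParts-invP σ (σΔ , σΔ′) = onΔ , onΔ′
    where
    onΔ : ∀ i → ∃[ j ] Inverse.from σ (inj₁ i) ≡ inj₁ j
    onΔ i with Inverse.from σ (inj₁ i) in eq
    ... | inj₁ j = j , refl
    ... | inj₂ k with () ← trans (sym (proj₂ (σΔ′ k))) (trans (cong (app σ) (sym eq)) (app-from σ (inj₁ i)))
    onΔ′ : ∀ i → ∃[ j ] Inverse.from σ (inj₂ i) ≡ inj₂ j
    onΔ′ i with Inverse.from σ (inj₂ i) in eq
    ... | inj₂ j = j , refl
    ... | inj₁ k with () ← trans (sym (proj₂ (σΔ k))) (trans (cong (app σ) (sym eq)) (app-from σ (inj₂ i)))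

  restrict : (σ : Perm (V n)) (ι : Fin n → V n) → (∀ {i j} → ι i ≡ ι j → i ≡ j) →
    (∀ i → ∃[ j ] app σ (ι i) ≡ ι j) → (∀ i → ∃[ j ] Inverse.from σ (ι i) ≡ ι j) → Permutation′ n
  restrict σ ι ι-injective σ-on σ⁻¹-on = mk↔ₛ′ (proj₁ ∘ σ-on) (proj₁ ∘ σ⁻¹-on) to∘from from∘to
    where
    open ≡-Reasoning
    to∘from : ∀ i → proj₁ (σ-on (proj₁ (σ⁻¹-on i))) ≡ i
    to∘from i = ι-injective (begin
      ι (proj₁ (σ-on (proj₁ (σ⁻¹-on i))))  ≡⟨ sym (proj₂ (σ-on _)) ⟩
      app σ (ι (proj₁ (σ⁻¹-on i)))         ≡⟨ cong (app σ) (sym (proj₂ (σ⁻¹-on i))) ⟩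
      app σ (Inverse.from σ (ι i))         ≡⟨ app-from σ (ι i) ⟩
      ι i                                  ∎)
    from∘to : ∀ i → proj₁ (σ⁻¹-on (proj₁ (σ-on i))) ≡ i
    from∘to i = ι-injective (begin
      ι (proj₁ (σ⁻¹-on (proj₁ (σ-on i))))  ≡⟨ sym (proj₂ (σ⁻¹-on _)) ⟩
      Inverse.from σ (ι (proj₁ (σ-on i)))  ≡⟨ cong (Inverse.from σ) (sym (proj₂ (σ-on i))) ⟩
      Inverse.from σ (app σ (ι i))         ≡⟨ from-app σ (ι i) ⟩
      ι i                                  ∎)

  PreservesParts⇒SymSym : (σ : Perm (V n)) → PreservesParts σ → SymSym n σ
  PreservesParts⇒SymSym σ (σΔ , σΔ′) = g , g′ , pair≈σ
    where
    σ⁻¹-pres = PreservesParts-invP σ (σΔ , σΔ′)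
    g = restrict σ inj₁ inj₁-injective σΔ (proj₁ σ⁻¹-pres)
    g′ = restrict σ inj₂ inj₂-injective σΔ′ (proj₂ σ⁻¹-pres)
    pair≈σ : pair g g′ ≈ₚ σ
    pair≈σ (inj₁ i) = sym (proj₂ (σΔ i))
    pair≈σ (inj₂ i) = sym (proj₂ (σΔ′ i))

  pair-∘ₚ : (g g′ h h′ : Permutation′ n) (σ τ : Perm (V n)) →
    pair g g′ ≈ₚ σ → pair h h′ ≈ₚ τ → pair (g ∘ₚ h) (g′ ∘ₚ h′) ≈ₚ (σ · τ)
  pair-∘ₚ g g′ h h′ σ τ pair≈σ pair≈τ (inj₁ i) = trans (pair≈τ (inj₁ (g ⟨$⟩ʳ i))) (cong (app τ) (pair≈σ (inj₁ i)))
  pair-∘ₚ g g′ h h′ σ τ pair≈σ pair≈τ (inj₂ i) = trans (pair≈τ (inj₂ (g′ ⟨$⟩ʳ i))) (cong (app τ) (pair≈σ (inj₂ i)))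

  pair-flip : (g g′ : Permutation′ n) (σ : Perm (V n)) → pair g g′ ≈ₚ σ → pair (flip g) (flip g′) ≈ₚ invP σ
  pair-flip g g′ σ pair≈σ x = begin
    app (pair (flip g) (flip g′)) x                                 ≡⟨ from-app σ _ ⟨
    Inverse.from σ (app σ (app (pair (flip g) (flip g′)) x))       ≡⟨ cong (Inverse.from σ) (pair≈σ _) ⟨
    Inverse.from σ (app (pair g g′) (app (pair (flip g) (flip g′)) x)) ≡⟨ cong (Inverse.from σ) (cancel x) ⟩
    Inverse.from σ x                                                ∎
    where
    open ≡-Reasoning
    cancel : ∀ x → app (pair g g′) (app (pair (flip g) (flip g′)) x) ≡ x
    cancel (inj₁ i) = cong inj₁ (inverseʳ g)
    cancel (inj₂ i) = cong inj₂ (inverseʳ g′)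

module _ {n : ℕ} {G : Perm (V n) → Set} (G-subgroup : IsSubgroup G) (SymSym⊆G : ∀ σ → SymSym n σ → G σ) where

  open IsSubgroup G-subgroup renaming (resp to G-resp)

  SwapsParts-∈ : ∀ {σ} → G σ → SwapsParts σ → ∀ τ → SwapsParts τ → G τ
  SwapsParts-∈ {σ} Gσ σ-swaps τ τ-swaps = G-resp (λ x → cong (app τ) (app-from σ x)) (mul (inv Gσ) G[σ·τ])
    where
    G[σ·τ] : G (σ · τ)
    G[σ·τ] = SymSym⊆G (σ · τ) (PreservesParts⇒SymSym (σ · τ) (SwapsParts-· σ τ σ-swaps τ-swaps))

module _ {n k : ℕ} (c : V n → Fin k) where

  pair-components-preserve : (g g′ : Permutation′ n) (σ : Perm (V n)) → pair g g′ ≈ₚ σ →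
    (∀ x → c (app σ x) ≡ c x) →
    (∀ i → c (inj₁ (g ⟨$⟩ʳ i)) ≡ c (inj₁ i)) × (∀ i → c (inj₂ (g′ ⟨$⟩ʳ i)) ≡ c (inj₂ i))
  pair-components-preserve g g′ σ pair≈σ σ-pres =
    (λ i → trans (cong c (pair≈σ (inj₁ i))) (σ-pres (inj₁ i))) ,
    (λ i → trans (cong c (pair≈σ (inj₂ i))) (σ-pres (inj₂ i)))

  PreservesParts⇒≈ₚidP : (σ : Perm (V n)) → Injective _≡_ _≡_ (c ∘ inj₁) → Injective _≡_ _≡_ (c ∘ inj₂) →
    PreservesParts σ → (∀ x → c (app σ x) ≡ c x) → σ ≈ₚ idP
  PreservesParts⇒≈ₚidP σ cΔ-injective cΔ′-injective (σΔ , σΔ′) σ-pres (inj₁ i) =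
    let j , σv≡v = σΔ i in trans σv≡v (cong inj₁ (cΔ-injective (trans (sym (cong c σv≡v)) (σ-pres (inj₁ i)))))
  PreservesParts⇒≈ₚidP σ cΔ-injective cΔ′-injective (σΔ , σΔ′) σ-pres (inj₂ i) =
    let j , σu≡u = σΔ′ i in trans σu≡u (cong inj₂ (cΔ′-injective (trans (sym (cong c σu≡u)) (σ-pres (inj₂ i)))))

IsDistinguishing : {n k : ℕ} → (Perm (V n) → Set) → (V n → Fin k) → Set
IsDistinguishing G c = ∀ σ → G σ → (∀ x → c (app σ x) ≡ c x) → σ ≈ₚ idP

module _ {n : ℕ} {G : Perm (V n) → Set} where

  distinguishingNumber : ∀ {d} → Distinguishes G d → (∀ {k} → k < d → ¬ Distinguishes G k) → DistNumberIs G d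
  distinguishingNumber D no-fewer = D , λ k Dₖ → ≮⇒≥ (λ k<d → no-fewer k<d Dₖ)

  module _ {k : ℕ} (c : V n → Fin k) where

    IsDistinguishing⇒pair≈id : IsDistinguishing G c → (g g′ : Permutation′ n) → G (pair g g′) →
      (∀ i → c (inj₁ (g ⟨$⟩ʳ i)) ≡ c (inj₁ i)) → (∀ i → c (inj₂ (g′ ⟨$⟩ʳ i)) ≡ c (inj₂ i)) →
      g ≈ id × g′ ≈ id
    IsDistinguishing⇒pair≈id c-dist g g′ G-pair g-pres g′-pres =
      (λ i → inj₁-injective (pair≈id (inj₁ i))) , (λ i → inj₂-injective (pair≈id (inj₂ i)))
      where
      pair≈id : pair g g′ ≈ₚ idP
      pair≈id = c-dist (pair g g′) G-pair λ { (inj₁ i) → g-pres i ; (inj₂ i) → g′-pres i }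

pair≈ₚidP : ∀ {n} (g g′ : Permutation′ n) (σ : Perm (V n)) → pair g g′ ≈ₚ σ → g ≈ id → g′ ≈ id → σ ≈ₚ idP
pair≈ₚidP g g′ σ pair≈σ g≈id g′≈id (inj₁ i) = trans (sym (pair≈σ (inj₁ i))) (cong inj₁ (g≈id i))
pair≈ₚidP g g′ σ pair≈σ g≈id g′≈id (inj₂ i) = trans (sym (pair≈σ (inj₂ i))) (cong inj₂ (g′≈id i))

-- Both part colourings are then bijections onto Fin k; matching equal colours across the parts
-- gives the swap.
colour-matching-swap : ∀ {n k} (c : V n → Fin k) → k ≤ n →
  Injective _≡_ _≡_ (c ∘ inj₁) → Injective _≡_ _≡_ (c ∘ inj₂) →
  ∃[ τ ] SwapsParts τ × (∀ x → c (app τ x) ≡ c x)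
colour-matching-swap {n} c k≤n cΔ-injective cΔ′-injective = τ , swaps , preserves
  where
  match : ∀ i → ∃[ j ] c (inj₂ j) ≡ c (inj₁ i)
  match i = injective⇒surjective k≤n (c ∘ inj₂) cΔ′-injective (c (inj₁ i))
  match′ : ∀ j → ∃[ i ] c (inj₁ i) ≡ c (inj₂ j)
  match′ j = injective⇒surjective k≤n (c ∘ inj₁) cΔ-injective (c (inj₂ j))
  swap : V n → V n
  swap (inj₁ i) = inj₂ (proj₁ (match i))
  swap (inj₂ j) = inj₁ (proj₁ (match′ j))
  swap-involutive : ∀ x → swap (swap x) ≡ x
  swap-involutive (inj₁ i) = cong inj₁ (cΔ-injective (trans (proj₂ (match′ _)) (proj₂ (match i))))
  swap-involutive (inj₂ j) = cong inj₂ (cΔ′-injective (trans (proj₂ (match _)) (proj₂ (match′ j))))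
  τ : Perm (V n)
  τ = mk↔ₛ′ swap swap swap-involutive swap-involutive
  swaps : SwapsParts τ
  swaps = (λ i → proj₁ (match i) , refl) , (λ j → proj₁ (match′ j) , refl)
  preserves : ∀ x → c (app τ x) ≡ c x
  preserves (inj₁ i) = proj₂ (match i)
  preserves (inj₂ j) = proj₂ (match′ j)

-- The three cases

module AltAltCase (m : ℕ) {G : Perm (V (3 + m)) → Set}
  (G-aut : ∀ σ → G σ → IsAut σ) (G⁺≐AltAlt : Plus G ≐ AltAlt (3 + m)) where

  -- v₀, v₁ share colour 0 and u₁, u₂ share colour 1; colour 0 occurs only once in Δ′, so no
  -- part swap preserves the colouring.
  colouring : V (3 + m) → Fin (2 + m)
  colouring (inj₁ i) = pinch zero i
  colouring (inj₂ i) = pinch (suc zero) i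

  colouring-surjective : Surjective _≡_ _≡_ colouring
  colouring-surjective y with x , pinch≡y ← Finₚ.pinch-surjective zero y = inj₁ x , λ { refl → pinch≡y refl }

  colouring-distinguishing : IsDistinguishing G colouring
  colouring-distinguishing σ Gσ σ-pres with app σ (inj₁ zero) in σv₀≡
  ... | inj₂ a = contradiction (↔-injective σ (trans σv₀≡u₀ (sym σv₁≡u₀))) λ ()
    where
    σ-swaps = IsAut⇒SwapsParts σ (G-aut σ Gσ) σv₀≡
    σv₁≡ = proj₂ (proj₁ σ-swaps (suc zero))
    σv₀≡u₀ : app σ (inj₁ zero) ≡ inj₂ zero
    σv₀≡u₀ = trans σv₀≡ (cong inj₂ (pinch-suc≡zero (trans (sym (cong colouring σv₀≡)) (σ-pres (inj₁ zero)))))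
    σv₁≡u₀ : app σ (inj₁ (suc zero)) ≡ inj₂ zero
    σv₁≡u₀ = trans σv₁≡ (cong inj₂ (pinch-suc≡zero (trans (sym (cong colouring σv₁≡)) (σ-pres (inj₁ (suc zero))))))
  ... | inj₁ _
    with g , g′ , g-even , g′-even , pair≈σ ←
           proj₁ (G⁺≐AltAlt σ) (Gσ , IsAut⇒PreservesParts₁ σ (G-aut σ Gσ) σv₀≡) =
    pair≈ₚidP g g′ σ pair≈σ (even-injectiveAwayFrom⇒≈id (pinch-injectiveAwayFrom zero) g g-pres g-even)
                     (even-injectiveAwayFrom⇒≈id (pinch-injectiveAwayFrom (suc zero)) g′ g′-pres g′-even)
    where
    g-pres = proj₁ (pair-components-preserve colouring g g′ σ pair≈σ σ-pres)
    g′-pres = proj₂ (pair-components-preserve colouring g g′ σ pair≈σ σ-pres)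

  -- Pigeonhole twice in Δ: vᵢ, vⱼ share a colour, and so do vₐ, v_b with j ∉ {a, b}; the even
  -- permutation (a b) then (i j) preserves the colouring but moves vⱼ.
  no-fewer-colours : ∀ {k} → k < 2 + m → ¬ Distinguishes G k
  no-fewer-colours {k} k<n-1 (c , _ , c-dist) = i≢j (trans (sym gj≡i) (proj₁ g≈id j))
    where
    cΔ = λ i → c (inj₁ i)
    pigeon₁ = Finₚ.pigeonhole (m<n⇒m<1+n k<n-1) cΔ
    i = proj₁ pigeon₁
    j = proj₁ (proj₂ pigeon₁)
    i≢j = Finₚ.<⇒≢ (proj₁ (proj₂ (proj₂ pigeon₁)))
    pigeon₂ = Finₚ.pigeonhole k<n-1 (cΔ ∘ punchIn j)
    a = punchIn j (proj₁ pigeon₂)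
    b = punchIn j (proj₁ (proj₂ pigeon₂))
    a≢b = Finₚ.<⇒≢ (proj₁ (proj₂ (proj₂ pigeon₂))) ∘ Finₚ.punchIn-injective j _ _
    g = transpose a b ∘ₚ transpose i j
    G-pair : G (pair g id)
    G-pair = proj₁ (proj₂ (G⁺≐AltAlt (pair g id))
      (g , id , odd∘ₚodd-even (transpose a b) (transpose i j) (transpose-odd a≢b) (transpose-odd i≢j) ,
       id-even {3 + m} , λ _ → refl))
    g≈id = IsDistinguishing⇒pair≈id c c-dist g id G-pair
      (λ z → trans (transpose-preserves cΔ (proj₂ (proj₂ (proj₂ pigeon₁))) _)
                   (transpose-preserves cΔ (proj₂ (proj₂ (proj₂ pigeon₂))) z))
      (λ _ → refl)
    gj≡i : g ⟨$⟩ʳ j ≡ i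
    gj≡i = trans (cong (PC.transpose i j) (transpose-other (Finₚ.punchInᵢ≢i j _ ∘ sym) (Finₚ.punchInᵢ≢i j _ ∘ sym)))
                 (transpose-matchʳ i j)

  distNumber : DistNumberIs G (2 + m)
  distNumber = distinguishingNumber (colouring , colouring-surjective , colouring-distinguishing) no-fewer-colours

-- For n = 2 the group Alt(2) × Alt(2) is trivial, so |G| ≤ 2 and G cannot be transitive on
-- the four vertices.
AltAlt₂-intransitive : {G : Perm (V 2) → Set} → (∀ σ → G σ → IsAut σ) → Transitive G → ¬ (Plus G ≐ AltAlt 2)
AltAlt₂-intransitive G-aut G-trans G⁺≐AltAlt
  with σ , Gσ , σv₀≡v₁ ← G-trans (inj₁ zero) (inj₁ (suc zero))
  with g , _ , g-even , _ , pair≈σ ← proj₁ (G⁺≐AltAlt σ) (Gσ , IsAut⇒PreservesParts₁ σ (G-aut σ Gσ) σv₀≡v₁) =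
  contradiction (trans (sym (g≈id zero)) (inj₁-injective (trans (pair≈σ (inj₁ zero)) σv₀≡v₁))) λ ()
  where
  trivially-injective : InjectiveAwayFrom {2} (λ _ → tt) zero
  trivially-injective {suc zero} {suc zero} _ _ _ = refl
  trivially-injective {zero} x≢0 _ _ = contradiction refl x≢0
  trivially-injective {_} {zero} _ y≢0 _ = contradiction refl y≢0
  g≈id : g ≈ id
  g≈id = even-injectiveAwayFrom⇒≈id trivially-injective g (λ _ → refl) g-even

AltAlt⇒distNumber : ∀ m {G : Perm (V (2 + m)) → Set} → (∀ σ → G σ → IsAut σ) → Transitive G →
  Plus G ≐ AltAlt (2 + m) → DistNumberIs G (1 + m)
AltAlt⇒distNumber zero G-aut G-trans G⁺≐AltAlt = contradiction G⁺≐AltAlt (AltAlt₂-intransitive G-aut G-trans)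
AltAlt⇒distNumber (suc m) G-aut _ G⁺≐AltAlt = AltAltCase.distNumber m G-aut G⁺≐AltAlt

module _ {n : ℕ} (h : 2 ≤ n) where

  AltAltT⇒sameParity : ∀ {σ} → AltAltT n h σ →
    ∃[ g ] ∃[ g′ ] pair g g′ ≈ₚ σ × inversions g % 2 ≡ inversions g′ % 2
  AltAltT⇒sameParity (gen (inj₁ (g , g′ , g-even , g′-even , pair≈σ))) =
    g , g′ , pair≈σ , trans g-even (sym g′-even)
  AltAltT⇒sameParity (gen (inj₂ pair≈σ)) = t12 h , t12 h , pair≈σ , refl
  AltAltT⇒sameParity gid = id , id , (λ { (inj₁ _) → refl ; (inj₂ _) → refl }) , refl
  AltAltT⇒sameParity (gmul {σ} {τ} σ∈ τ∈)
    with g , g′ , pair≈σ , g∼g′ ← AltAltT⇒sameParity σ∈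
       | k , k′ , pair≈τ , k∼k′ ← AltAltT⇒sameParity τ∈ =
    g ∘ₚ k , g′ ∘ₚ k′ , pair-∘ₚ g g′ k k′ σ τ pair≈σ pair≈τ , (begin
      inversions (g ∘ₚ k) % 2                      ≡⟨ inversions-∘ₚ g k ⟩
      (inversions g + inversions k) % 2            ≡⟨ %-distribˡ-+ (inversions g) (inversions k) 2 ⟩
      (inversions g % 2 + inversions k % 2) % 2    ≡⟨ cong₂ (λ x y → (x + y) % 2) g∼g′ k∼k′ ⟩
      (inversions g′ % 2 + inversions k′ % 2) % 2  ≡⟨ %-distribˡ-+ (inversions g′) (inversions k′) 2 ⟨
      (inversions g′ + inversions k′) % 2          ≡⟨ inversions-∘ₚ g′ k′ ⟨
      inversions (g′ ∘ₚ k′) % 2                    ∎)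
    where open ≡-Reasoning
  AltAltT⇒sameParity (ginv {σ} σ∈) with g , g′ , pair≈σ , g∼g′ ← AltAltT⇒sameParity σ∈ =
    flip g , flip g′ , pair-flip g g′ σ pair≈σ , trans (inversions-flip g) (trans g∼g′ (sym (inversions-flip g′)))
  AltAltT⇒sameParity (gresp σ≈τ σ∈) with g , g′ , pair≈σ , g∼g′ ← AltAltT⇒sameParity σ∈ =
    g , g′ , (λ x → trans (pair≈σ x) (σ≈τ x)) , g∼g′

  sameParity⇒AltAltT : (g g′ : Permutation′ n) → inversions g % 2 ≡ inversions g′ % 2 → AltAltT n h (pair g g′)
  sameParity⇒AltAltT g g′ g∼g′ with %2≡0⊎%2≡1 (inversions g)
  ... | inj₁ g-parity = gen (inj₁ (g , g′ , g-parity , trans (sym g∼g′) g-parity , λ _ → refl))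
  ... | inj₂ g-parity =
    gresp undo-t (gmul {σ = pair (g ∘ₚ t) (g′ ∘ₚ t)}
      (gen (inj₁ (g ∘ₚ t , g′ ∘ₚ t , odd∘ₚodd-even g t g-parity t-odd ,
                  odd∘ₚodd-even g′ t (trans (sym g∼g′) g-parity) t-odd , λ _ → refl)))
      (ginv {σ = pair t t} (gen (inj₂ λ _ → refl))))
    where
    t = t12 h
    t-odd : inversions t % 2 ≡ 1
    t-odd = transpose-odd 0≢1
      where
      0≢1 : fromℕ< {0} (≤-trans (s≤s z≤n) h) ≢ fromℕ< {1} h
      0≢1 eq = 0≢1+n (trans (sym (Finₚ.toℕ-fromℕ< _)) (trans (cong toℕ eq) (Finₚ.toℕ-fromℕ< _)))
    undo-t : (pair (g ∘ₚ t) (g′ ∘ₚ t) · invP (pair t t)) ≈ₚ pair g g′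
    undo-t (inj₁ i) = cong inj₁ (inverseˡ t)
    undo-t (inj₂ i) = cong inj₂ (inverseˡ t)

module AltAltTCase (m : ℕ) {G : Perm (V (2 + m)) → Set}
  (G-aut : ∀ σ → G σ → IsAut σ) (G⁺≐AltAltT : Plus G ≐ AltAltT (2 + m) (s≤s (s≤s z≤n))) where

  h : 2 ≤ 2 + m
  h = s≤s (s≤s z≤n)

  colourΔ′ : Fin (2 + m) → Fin (2 + m)
  colourΔ′ = suc ∘ pinch zero

  -- Colour 0 occurs only at v₀, and only u₀, u₁ share a colour.
  colouring : V (2 + m) → Fin (2 + m)
  colouring (inj₁ i) = i
  colouring (inj₂ i) = colourΔ′ i

  colouring-surjective : Surjective _≡_ _≡_ colouring
  colouring-surjective y = inj₁ y , λ { refl → refl }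

  colouring-distinguishing : IsDistinguishing G colouring
  colouring-distinguishing σ Gσ σ-pres with app σ (inj₁ zero) in σv₀≡
  ... | inj₂ a with () ← trans (sym (cong colouring σv₀≡)) (σ-pres (inj₁ zero))
  ... | inj₁ _
    with g , g′ , pair≈σ , g∼g′ ←
           AltAltT⇒sameParity h (proj₁ (G⁺≐AltAltT σ) (Gσ , IsAut⇒PreservesParts₁ σ (G-aut σ Gσ) σv₀≡)) =
    pair≈ₚidP g g′ σ pair≈σ g≈id g′≈id
    where
    g≈id : g ≈ id
    g≈id = proj₁ (pair-components-preserve colouring g g′ σ pair≈σ σ-pres)
    g′-even : IsEven g′
    g′-even = trans (sym g∼g′) (cong (_% 2) (trans (inversions-cong g id g≈id) (inversions-id {2 + m})))
    g′≈id : g′ ≈ id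
    g′≈id = even-injectiveAwayFrom⇒≈id
      (λ x≢ y≢ → pinch-injectiveAwayFrom zero x≢ y≢ ∘ Finₚ.suc-injective)
      g′ (proj₂ (pair-components-preserve colouring g g′ σ pair≈σ σ-pres)) g′-even

  no-fewer-colours : ∀ {k} → k < 2 + m → ¬ Distinguishes G k
  no-fewer-colours {k} k<n (c , _ , c-dist) = transpose≉id i≢j (proj₁ swaps≈id)
    where
    cΔ = λ i → c (inj₁ i)
    cΔ′ = λ i → c (inj₂ i)
    pigeon = Finₚ.pigeonhole k<n cΔ
    pigeon′ = Finₚ.pigeonhole k<n cΔ′
    i = proj₁ pigeon
    j = proj₁ (proj₂ pigeon)
    i≢j = Finₚ.<⇒≢ (proj₁ (proj₂ (proj₂ pigeon)))
    a = proj₁ pigeon′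
    b = proj₁ (proj₂ pigeon′)
    a≢b = Finₚ.<⇒≢ (proj₁ (proj₂ (proj₂ pigeon′)))
    G-swaps : G (pair (transpose i j) (transpose a b))
    G-swaps = proj₁ (proj₂ (G⁺≐AltAltT _)
      (sameParity⇒AltAltT h (transpose i j) (transpose a b) (trans (transpose-odd i≢j) (sym (transpose-odd a≢b)))))
    swaps≈id = IsDistinguishing⇒pair≈id c c-dist (transpose i j) (transpose a b) G-swaps
      (transpose-preserves cΔ (proj₂ (proj₂ (proj₂ pigeon))))
      (transpose-preserves cΔ′ (proj₂ (proj₂ (proj₂ pigeon′))))

  distNumber : DistNumberIs G (2 + m)
  distNumber = distinguishingNumber (colouring , colouring-surjective , colouring-distinguishing) no-fewer-colours

module SymSymCase (m : ℕ) {G : Perm (V (suc m)) → Set} (G-subgroup : IsSubgroup G)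
  (G-aut : ∀ σ → G σ → IsAut σ) (G-trans : Transitive G) (G⁺≐SymSym : Plus G ≐ SymSym (suc m)) where

  SymSym⊆G : ∀ σ → SymSym (suc m) σ → G σ
  SymSym⊆G σ σ∈ = proj₁ (proj₂ (G⁺≐SymSym σ) σ∈)

  colouring : V (suc m) → Fin (2 + m)
  colouring (inj₁ i) = suc i
  colouring (inj₂ zero) = zero
  colouring (inj₂ (suc i)) = suc (suc i)

  colouringΔ′-injective : Injective _≡_ _≡_ (colouring ∘ inj₂)
  colouringΔ′-injective {zero} {zero} _ = refl
  colouringΔ′-injective {suc i} {suc j} eq = cong suc (Finₚ.suc-injective (Finₚ.suc-injective eq))

  colouring-surjective : Surjective _≡_ _≡_ colouring
  colouring-surjective zero = inj₂ zero , λ { refl → refl }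
  colouring-surjective (suc i) = inj₁ i , λ { refl → refl }

  colouring≡zero : ∀ x → colouring x ≡ zero → x ≡ inj₂ zero
  colouring≡zero (inj₂ zero) _ = refl

  colouring-distinguishing : IsDistinguishing G colouring
  colouring-distinguishing σ Gσ σ-pres =
    PreservesParts⇒≈ₚidP colouring σ Finₚ.suc-injective colouringΔ′-injective σ-preserves σ-pres
    where
    σ-preserves = IsAut⇒PreservesParts₂ σ (G-aut σ Gσ) (colouring≡zero _ (σ-pres (inj₂ zero)))

  -- Either a part has two vertices of one colour, swapped by a transposition in Sym(n) × Sym(n),
  -- or both parts are coloured bijectively and the colour-matching part swap lies in G.
  no-fewer-colours : ∀ {k} → k < 2 + m → ¬ Distinguishes G k
  no-fewer-colours {k} k<n+1 (c , _ , c-dist)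
    with injective-or-collision (c ∘ inj₁) | injective-or-collision (c ∘ inj₂)
  ... | inj₂ (i , j , i≢j , same) | _ = transpose≉id i≢j (proj₁ (IsDistinguishing⇒pair≈id c c-dist
    (transpose i j) id (SymSym⊆G _ (transpose i j , id , λ _ → refl)) (transpose-preserves (c ∘ inj₁) same) (λ _ → refl)))
  ... | inj₁ _ | inj₂ (i , j , i≢j , same) = transpose≉id i≢j (proj₂ (IsDistinguishing⇒pair≈id c c-dist
    id (transpose i j) (SymSym⊆G _ (id , transpose i j , λ _ → refl)) (λ _ → refl) (transpose-preserves (c ∘ inj₂) same)))
  ... | inj₁ cΔ-injective | inj₁ cΔ′-injective
    with τ , τ-swaps , τ-pres ← colour-matching-swap c (≤-pred k<n+1) cΔ-injective cΔ′-injective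
    with σ , Gσ , σv₀≡u₀ ← G-trans (inj₁ zero) (inj₂ zero) =
    u≢v (trans (sym (proj₂ (proj₁ τ-swaps zero))) (c-dist τ Gτ τ-pres (inj₁ zero)))
    where
    Gτ : G τ
    Gτ = SwapsParts-∈ G-subgroup SymSym⊆G Gσ (IsAut⇒SwapsParts σ (G-aut σ Gσ) σv₀≡u₀) τ τ-swaps
    u≢v : ∀ {i j} → inj₂ i ≢ inj₁ j
    u≢v ()

  distNumber : DistNumberIs G (2 + m)
  distNumber = distinguishingNumber (colouring , colouring-surjective , colouring-distinguishing) no-fewer-colours

proposition3p1 : (n : ℕ) (h : 2 ≤ n) (G : Perm (V n) → Set) →
    IsSubgroup G →
    (∀ σ → G σ → IsAut σ) →
    (∀ σ → AltAlt n σ → G σ) →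
    Transitive G →
    ((Plus G ≐ AltAlt n → DistNumberIs G (n ∸ 1)) ×
     (Plus G ≐ AltAltT n h → DistNumberIs G n) ×
     (Plus G ≐ SymSym n → DistNumberIs G (n + 1)))
proposition3p1 (suc (suc m)) (s≤s (s≤s z≤n)) G G-subgroup G-aut _ G-trans =
  AltAlt⇒distNumber m G-aut G-trans ,
  AltAltTCase.distNumber m G-aut ,
  λ G⁺≐SymSym → subst (DistNumberIs G) (+-comm 1 (2 + m))
                  (SymSymCase.distNumber (suc m) G-subgroup G-aut G-trans G⁺≐SymSym)
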